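{- Let $H$ be the Shrikhande graph, i.e. the graph with vertex set $\mathbb{Z}_4\times\mathbb{Z}_4$ in which distinct vertices $(a,b)$ and $(c,d)$ are adjacent if and only if their difference $(a-c,\,b-d)$ (computed mod $4$) lies in $\{(0,1),(0,3),(1,0),(3,0),(1,1),(3,3)\}$. Let $\overline{H}$ be its complement. Then $\overline{H}$ contains no induced subgraph isomorphic to $4K_1$ and, for every $\ell\ge 6$, no induced subgraph isomorphic to the cycle $C_\ell$; moreover the cop number of $\overline{H}$ is $c(\overline{H})=3$.
   Context: All graphs are finite, simple and undirected. $4K_1$ denotes the edgeless graph on $4$ vertices; $C_\ell$ the cycle on $\ell$ vertices. The game of cops and robber on a connected graph $G$: first the cops are placed on vertices, then the robber chooses a vertex; then the players alternate, in each cops' turn every cop moves to an adjacent vertex or stays, and in each robber's turn the robber moves to an adjacent vertex or stays. Both sides have full information. The cops win if at some point a cop occupies the same vertex as the robber. The cop number $c(G)$ is the minimum number of cops that guarantees a win for the cops. -}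

module Defs where

open import Data.Nat using (ℕ; zero; suc; _+_; _∸_; _%_; _<_)
open import Data.Empty using (⊥)
open import Data.Fin using (Fin; toℕ)
open import Data.Product using (Σ; _×_; _,_; ∃)
open import Data.Sum using (_⊎_)
open import Data.List using (List; []; _∷_)
open import Data.List.Membership.Propositional using (_∈_)
open import Relation.Binary.PropositionalEquality using (_≡_; _≢_)
open import Relation.Nullary using (¬_)
open import Function.Definitions using (Injective)

record Graph : Set₁ where
  field
    V : Set
    E : V → V → Set

open Graph public

Z4 : Set
Z4 = Fin 4

diff4 : Z4 → Z4 → ℕ
diff4 a c = (toℕ a + 4 ∸ toℕ c) % 4

ShrikhandeDiffs : List (ℕ × ℕ)
ShrikhandeDiffs =
  (0 , 1) ∷ (0 , 3) ∷ (1 , 0) ∷ (3 , 0) ∷ (1 , 1) ∷ (3 , 3) ∷ []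

ShrikhandeAdj : Z4 × Z4 → Z4 × Z4 → Set
ShrikhandeAdj (a , b) (c , d) =
  ((a , b) ≢ (c , d)) × ((diff4 a c , diff4 b d) ∈ ShrikhandeDiffs)

Shrikhande : Graph
Shrikhande = record { V = Z4 × Z4 ; E = ShrikhandeAdj }

complement : Graph → Graph
complement G = record { V = V G ; E = λ u v → (u ≢ v) × ¬ (E G u v) }

ShrikhandeComplement : Graph
ShrikhandeComplement = complement Shrikhande

InducedCopyOf : (n : ℕ) → (Fin n → Fin n → Set) → Graph → Set
InducedCopyOf n A G =
  Σ (Fin n → V G) λ f →
    Injective _≡_ _≡_ f ×
    (∀ i j → A i j → E G (f i) (f j)) ×
    (∀ i j → E G (f i) (f j) → A i j)

EmptyAdj : (n : ℕ) → Fin n → Fin n → Set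
EmptyAdj n i j = ⊥

HasInduced4K1 : Graph → Set
HasInduced4K1 G = InducedCopyOf 4 (EmptyAdj 4) G

CycSucc : (ℓ : ℕ) → Fin ℓ → Fin ℓ → Set
CycSucc ℓ i j = (suc (toℕ i) ≡ toℕ j) ⊎ ((suc (toℕ i) ≡ ℓ) × (toℕ j ≡ 0))

CycleAdj : (ℓ : ℕ) → Fin ℓ → Fin ℓ → Set
CycleAdj ℓ i j = CycSucc ℓ i j ⊎ CycSucc ℓ j i

HasInducedCycle : ℕ → Graph → Set
HasInducedCycle ℓ G = InducedCopyOf ℓ (CycleAdj ℓ) G

module _ (G : Graph) {k : ℕ} where

  Captured : (Fin k → V G) → V G → Set
  Captured cs r = ∃ λ i → cs i ≡ r

  CopMove : (Fin k → V G) → (Fin k → V G) → Set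
  CopMove cs cs' = ∀ i → (cs' i ≡ cs i) ⊎ E G (cs i) (cs' i)

  RobberMove : V G → V G → Set
  RobberMove r r' = (r' ≡ r) ⊎ E G r r'

  -- Inductively defined positions from which the cops can force capture
  -- (the least fixed point / attractor of the capture positions).
  mutual
    data CopTurnWin (cs : Fin k → V G) (r : V G) : Set where
      caughtC : Captured cs r → CopTurnWin cs r
      moveC   : (cs' : Fin k → V G) → CopMove cs cs' →
                RobTurnWin cs' r → CopTurnWin cs r

    data RobTurnWin (cs : Fin k → V G) (r : V G) : Set where
      caughtR : Captured cs r → RobTurnWin cs r
      moveR   : (∀ r' → RobberMove r r' → CopTurnWin cs r') →
                RobTurnWin cs r

-- k cops win on G: the cops choose initial positions, then the robber
-- chooses his vertex, then the cops move first and play alternates.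
CopsWin : Graph → ℕ → Set
CopsWin G k = Σ (Fin k → V G) λ cs → ∀ r → CopTurnWin G cs r

CopNumberIs : Graph → ℕ → Set
CopNumberIs G m = CopsWin G m × (∀ k → k < m → ¬ CopsWin G k)

-- The induced-subgraph claims are finite: an induced copy of a pattern is found by
-- placing its vertices one at a time, each compatible with those already placed, and
-- an exhaustive backtracking search over the 16 vertices shows no such placement of
-- 4K₁, C₆ or C₇ exists.  Every cycle of length at least 8 contains an induced 4K₁
-- (four vertices at even positions), so no longer cycle occurs either.
--
-- The complement of the Shrikhande graph is 9-regular, and the three vertices
-- (0,0), (0,1), (0,2) dominate it, so three cops win in one move.  Against two cops
-- the robber always has a vertex outside both cops' closed neighbourhoods, both to
-- start on and, from any unoccupied vertex, within one step; staying out of reach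
-- forever, he is never caught.  Since extra cops never hurt, fewer cops lose as well.
module Submission where

open import Defs
open import Data.Bool using (T)
open import Data.Bool.ListAction using (all; any)
open import Data.Empty using (⊥-elim)
open import Data.Fin as Fin using (Fin; zero; suc; toℕ; splitAt; _↑ˡ_; inject₁)
open import Data.Fin.Properties using (splitAt-↑ˡ; toℕ-injective)
open import Data.List using (List; []; _∷_; map; allFin; cartesianProduct)
open import Data.List.Relation.Unary.All as All using (All)
open import Data.List.Relation.Unary.All.Properties using (map⁺; all⁺; all⁻)
import Data.List.Relation.Unary.Any as Any
open import Data.List.Relation.Unary.Any.Properties using (any⁺; any⁻)
open import Data.List.Membership.Propositional using (_∈_)
open import Data.List.Membership.Propositional.Properties using (∈-allFin; ∈-cartesianProduct⁺)
import Data.List.Membership.DecPropositional as DecMembership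
open import Data.Nat as ℕ using (ℕ; _+_; _∸_; _*_; _≤_; _<_; s≤s⁻¹)
open import Data.Nat.Properties using (m+[n∸m]≡n; even≢odd; *-cancelˡ-≡)
open import Data.Product using (_×_; _,_; ∃; proj₁; proj₂)
open import Data.Product.Properties using (≡-dec)
open import Data.Sum as Sum using (_⊎_; inj₁; inj₂; [_,_]′)
open import Data.Unit using (⊤; tt)
open import Data.Vec.Functional using (updateAt)
open import Data.Vec.Functional.Properties using (updateAt-updates; updateAt-minimal)
open import Function using (_∘_; const)
open import Level using (0ℓ)
open import Relation.Binary.Definitions using (Decidable; DecidableEquality)
open import Relation.Binary.PropositionalEquality using (_≡_; _≢_; refl; sym; trans; cong; subst)
open import Relation.Nullary using (¬_; Dec; yes; no; isYes)
open import Relation.Nullary.Decidable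
  using (¬?; _×-dec_; _⊎-dec_; _→-dec_; map′; T?; toWitness; fromWitness; False; toWitnessFalse)
open import Relation.Unary as Unary using (Pred)

complement-adj? : (G : Graph) → DecidableEquality (V G) → Decidable (E G) →
                  Decidable (E (complement G))
complement-adj? G _≟_ adj? u v = ¬? (u ≟ v) ×-dec ¬? (adj? u v)

-- The decisions are computed by a Boolean fold over the enumeration: composing
-- `Dec`s instead makes large searches use gigabytes of memory during type checking.
module FiniteSearch {A : Set} (xs : List A) (complete : ∀ x → x ∈ xs) where

  forall? : {P : Pred A 0ℓ} → Unary.Decidable P → Dec (∀ x → P x)
  forall? {P} P? = map′ sound complete′ (T? (all (isYes ∘ P?) xs))
    where
    sound : T (all (isYes ∘ P?) xs) → ∀ x → P x
    sound h x = toWitness {a? = P? x} (All.lookup (all⁺ (isYes ∘ P?) xs h) (complete x))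

    complete′ : (∀ x → P x) → T (all (isYes ∘ P?) xs)
    complete′ h =
      all⁻ (isYes ∘ P?) {xs} (All.tabulate λ {x} _ → fromWitness {a? = P? x} (h x))

  exists? : {P : Pred A 0ℓ} → Unary.Decidable P → Dec (∃ P)
  exists? {P} P? = map′ sound complete′ (T? (any (isYes ∘ P?) xs))
    where
    sound : T (any (isYes ∘ P?) xs) → ∃ P
    sound h with Any.satisfied (any⁻ (isYes ∘ P?) xs h)
    ... | x , px = x , toWitness {a? = P? x} px

    complete′ : ∃ P → T (any (isYes ∘ P?) xs)
    complete′ (x , px) =
      any⁺ (isYes ∘ P?) (Any.map (λ { refl → fromWitness {a? = P? x} px }) (complete x))

module _ (G : Graph) {n : ℕ} (A : Fin n → Fin n → Set) where

  Compatible : Fin n → Fin n → V G → V G → Set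
  Compatible i j u v = (A i j → E G u v) × (E G u v → A i j) × (u ≡ v → i ≡ j)

  Extendable : List (Fin n × V G) → List (Fin n) → Set
  Extendable placed []       = ⊤
  Extendable placed (i ∷ is) =
    ∃ λ v → All (λ (j , u) → Compatible i j v u) placed × Extendable ((i , v) ∷ placed) is

  induced⇒compatible : (c : InducedCopyOf n A G) →
                       ∀ i j → Compatible i j (proj₁ c i) (proj₁ c j)
  induced⇒compatible (f , inj , fw , bw) i j = fw i j , bw i j , inj

  induced⇒extendable : (c : InducedCopyOf n A G) →
                       ∀ js is → Extendable (map (λ j → j , proj₁ c j) js) is
  induced⇒extendable c js []       = tt
  induced⇒extendable c js (i ∷ is) =
    proj₁ c i ,
    map⁺ (All.universal (induced⇒compatible c i) js) ,
    induced⇒extendable c (i ∷ js) is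

  ¬extendable⇒¬induced : ¬ Extendable [] (allFin n) → ¬ InducedCopyOf n A G
  ¬extendable⇒¬induced ¬ext c = ¬ext (induced⇒extendable c [] (allFin n))

  module _ (_≟_ : DecidableEquality (V G)) (A? : Decidable A) (adj? : Decidable (E G))
           (vertices : List (V G)) (complete : ∀ v → v ∈ vertices) where

    open FiniteSearch vertices complete using (exists?)

    -- Branching on adjacency first keeps the exhaustive search fast.
    compatible? : ∀ i j u v → Dec (Compatible i j u v)
    compatible? i j u v with adj? u v
    ... | yes e  = map′ (λ (a , inj) → const e , const a , inj)
                        (λ (_ , bw , inj) → bw e , inj)
                        (A? i j ×-dec (u ≟ v →-dec i Fin.≟ j))
    ... | no ¬e = map′ (λ (¬a , inj) → ⊥-elim ∘ ¬a , ⊥-elim ∘ ¬e , inj)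
                        (λ (fw , _ , inj) → ¬e ∘ fw , inj)
                        (¬? (A? i j) ×-dec (u ≟ v →-dec i Fin.≟ j))

    extendable? : ∀ placed is → Dec (Extendable placed is)
    extendable? placed []       = yes tt
    extendable? placed (i ∷ is) =
      exists? λ v → All.all? (λ (j , u) → compatible? i j v u) placed
                    ×-dec extendable? ((i , v) ∷ placed) is

cycleAdj? : ∀ ℓ → Decidable (CycleAdj ℓ)
cycleAdj? ℓ i j = succ? i j ⊎-dec succ? j i
  where
  succ? : Decidable (CycSucc ℓ)
  succ? i j = (ℕ.suc (toℕ i) ℕ.≟ toℕ j) ⊎-dec ((ℕ.suc (toℕ i) ℕ.≟ ℓ) ×-dec (toℕ j ℕ.≟ 0))

induced-restrict : ∀ {G m n} {A′ : Fin m → Fin m → Set} {A : Fin n → Fin n → Set}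
                   (g : Fin m → Fin n) → (∀ {i j} → g i ≡ g j → i ≡ j) →
                   (∀ i j → A′ i j → A (g i) (g j)) → (∀ i j → A (g i) (g j) → A′ i j) →
                   InducedCopyOf n A G → InducedCopyOf m A′ G
induced-restrict g g-inj fw′ bw′ (f , inj , fw , bw) =
  f ∘ g , g-inj ∘ inj , (λ i j → fw _ _ ∘ fw′ i j) , λ i j → bw′ i j ∘ bw _ _

module _ (m : ℕ) where

  evenVertex : Fin 4 → Fin (8 + m)
  evenVertex zero                   = zero
  evenVertex (suc zero)             = suc (suc zero)
  evenVertex (suc (suc zero))       = suc (suc (suc (suc zero)))
  evenVertex (suc (suc (suc zero))) = suc (suc (suc (suc (suc (suc zero)))))

  toℕ-evenVertex : ∀ i → toℕ (evenVertex i) ≡ 2 * toℕ i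
  toℕ-evenVertex zero                   = refl
  toℕ-evenVertex (suc zero)             = refl
  toℕ-evenVertex (suc (suc zero))       = refl
  toℕ-evenVertex (suc (suc (suc zero))) = refl

  evenVertex-injective : ∀ {i j} → evenVertex i ≡ evenVertex j → i ≡ j
  evenVertex-injective {i} {j} eq = toℕ-injective (*-cancelˡ-≡ (toℕ i) (toℕ j) 2 doubled)
    where
    doubled : 2 * toℕ i ≡ 2 * toℕ j
    doubled = trans (sym (toℕ-evenVertex i)) (trans (cong toℕ eq) (toℕ-evenVertex j))

  evenVertex-notLast : ∀ i → ℕ.suc (toℕ (evenVertex i)) ≢ 8 + m
  evenVertex-notLast zero                   ()
  evenVertex-notLast (suc zero)             ()
  evenVertex-notLast (suc (suc zero))       ()
  evenVertex-notLast (suc (suc (suc zero))) ()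

  evenVertex-¬succ : ∀ i j → ¬ CycSucc (8 + m) (evenVertex i) (evenVertex j)
  evenVertex-¬succ i j (inj₁ eq) =
    even≢odd (toℕ j) (toℕ i)
      (trans (sym (toℕ-evenVertex j)) (trans (sym eq) (cong ℕ.suc (toℕ-evenVertex i))))
  evenVertex-¬succ i j (inj₂ (eq , _)) = evenVertex-notLast i eq

  longCycle⇒4K1 : ∀ {G} → HasInducedCycle (8 + m) G → HasInduced4K1 G
  longCycle⇒4K1 {G} = induced-restrict {G} evenVertex evenVertex-injective (λ _ _ ())
    λ i j → [ evenVertex-¬succ i j , evenVertex-¬succ j i ]′

module _ (G : Graph) where

  ClosedNbhd : V G → V G → Set
  ClosedNbhd u v = u ≡ v ⊎ E G u v

  OutOfReach : ∀ {k} → (Fin k → V G) → V G → Set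
  OutOfReach cs r = ∀ i → ¬ ClosedNbhd (cs i) r

  dominating⇒copsWin : ∀ {k} (cs : Fin k → V G) → (∀ r → ∃ λ i → ClosedNbhd (cs i) r) →
                       CopsWin G k
  dominating⇒copsWin cs dom = cs , λ r → catch r (dom r)
    where
    catch : ∀ r → ∃ (λ i → ClosedNbhd (cs i) r) → CopTurnWin G cs r
    catch r (i , inj₁ eq) = caughtC (i , eq)
    catch r (i , inj₂ e)  =
      moveC (updateAt cs i (const r)) step (caughtR (i , updateAt-updates i cs))
      where
      step : CopMove G cs (updateAt cs i (const r))
      step j with j Fin.≟ i
      ... | yes refl = inj₂ (subst (E G (cs i)) (sym (updateAt-updates i cs)) e)
      ... | no j≢i   = inj₁ (updateAt-minimal j i cs j≢i)

  robberEvades : ∀ {k} → (∀ (cs : Fin k → V G) → ∃ (OutOfReach cs)) →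
                 (∀ cs r → (∀ i → cs i ≢ r) →
                   ∃ λ r′ → RobberMove G {k} r r′ × OutOfReach cs r′) →
                 ¬ CopsWin G k
  robberEvades start escape (cs₀ , win) =
    copsLose cs₀ (proj₁ (start cs₀)) (proj₂ (start cs₀)) (win (proj₁ (start cs₀)))
    where
    mutual
      copsLose : ∀ cs r → OutOfReach cs r → ¬ CopTurnWin G cs r
      copsLose cs r out (caughtC (i , eq))  = out i (inj₁ eq)
      copsLose cs r out (moveC cs′ move w) = copsLoseAfterMove cs′ r free w
        where
        free : ∀ i → cs′ i ≢ r
        free i eq = out i (subst (ClosedNbhd (cs i)) eq (Sum.map₁ sym (move i)))

      copsLoseAfterMove : ∀ cs r → (∀ i → cs i ≢ r) → ¬ RobTurnWin G cs r
      copsLoseAfterMove cs r free (caughtR (i , eq)) = free i eq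
      copsLoseAfterMove cs r free (moveR w) with escape cs r free
      ... | r′ , move , out = copsLose cs r′ out (w r′ move)

  module _ {k d : ℕ} (v : V G) where

    addCops : (Fin k → V G) → Fin (k + d) → V G
    addCops cs i = [ cs , const v ]′ (splitAt k i)

    addCops-captured : ∀ {cs r} → Captured G cs r → Captured G (addCops cs) r
    addCops-captured {cs} (i , eq) =
      i ↑ˡ d , trans (cong [ cs , const v ]′ (splitAt-↑ˡ k i d)) eq

    addCops-move : ∀ {cs cs′} → CopMove G cs cs′ → CopMove G (addCops cs) (addCops cs′)
    addCops-move {cs} {cs′} move i = lift (splitAt k i)
      where
      lift : ∀ s → ([ cs′ , const v ]′ s ≡ [ cs , const v ]′ s)
                   ⊎ E G ([ cs , const v ]′ s) ([ cs′ , const v ]′ s)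
      lift (inj₁ j) = move j
      lift (inj₂ _) = inj₁ refl

    mutual
      addCops-copTurnWin : ∀ {cs r} → CopTurnWin G cs r → CopTurnWin G (addCops cs) r
      addCops-copTurnWin (caughtC c)        = caughtC (addCops-captured c)
      addCops-copTurnWin (moveC cs′ move w) =
        moveC (addCops cs′) (addCops-move move) (addCops-robTurnWin w)

      addCops-robTurnWin : ∀ {cs r} → RobTurnWin G cs r → RobTurnWin G (addCops cs) r
      addCops-robTurnWin (caughtR c) = caughtR (addCops-captured c)
      addCops-robTurnWin (moveR w)   = moveR λ r′ move → addCops-copTurnWin (w r′ move)

    copsWin-+ : CopsWin G k → CopsWin G (k + d)
    copsWin-+ (cs , win) = addCops cs , addCops-copTurnWin ∘ win

H̄ : Graph
H̄ = ShrikhandeComplement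

Vertex : Set
Vertex = Z4 × Z4

_≟_ : DecidableEquality Vertex
_≟_ = ≡-dec Fin._≟_ Fin._≟_

vertices : List Vertex
vertices = cartesianProduct (allFin 4) (allFin 4)

vertices-complete : ∀ v → v ∈ vertices
vertices-complete (a , b) = ∈-cartesianProduct⁺ (∈-allFin a) (∈-allFin b)

open FiniteSearch vertices vertices-complete

shrikhandeAdj? : Decidable ShrikhandeAdj
shrikhandeAdj? (a , b) (c , d) =
  ¬? ((a , b) ≟ (c , d)) ×-dec (diff4 a c , diff4 b d) ∈? ShrikhandeDiffs
  where open DecMembership (≡-dec ℕ._≟_ ℕ._≟_)

adj? : Decidable (E H̄)
adj? = complement-adj? Shrikhande _≟_ shrikhandeAdj?

closedNbhd? : Decidable (ClosedNbhd H̄)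
closedNbhd? u v = (u ≟ v) ⊎-dec adj? u v

noInducedCopy : ∀ {n} (A : Fin n → Fin n → Set) (A? : Decidable A) →
                {_ : False (extendable? H̄ A _≟_ A? adj? vertices vertices-complete [] (allFin n))} →
                ¬ InducedCopyOf n A H̄
noInducedCopy A A? {¬ext} = ¬extendable⇒¬induced H̄ A (toWitnessFalse ¬ext)

no4K1 : ¬ HasInduced4K1 H̄
no4K1 = noInducedCopy (EmptyAdj 4) (λ _ _ → no λ ())

noInducedCycleFrom6 : ∀ m → ¬ HasInducedCycle (6 + m) H̄
noInducedCycleFrom6 0                 = noInducedCopy (CycleAdj 6) (cycleAdj? 6)
noInducedCycleFrom6 1                 = noInducedCopy (CycleAdj 7) (cycleAdj? 7)
noInducedCycleFrom6 (ℕ.suc (ℕ.suc m)) = no4K1 ∘ longCycle⇒4K1 m {H̄}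

threeCops : Fin 3 → Vertex
threeCops i = zero , inject₁ i

-- Opaque: otherwise type checking the uses below unfolds these facts and reruns the searches.
opaque
  threeCopsDominate : ∀ r → ∃ λ i → ClosedNbhd H̄ (threeCops i) r
  threeCopsDominate =
    toWitness {a? = forall? λ r → FiniteSearch.exists? (allFin 3) ∈-allFin λ i →
                                    closedNbhd? (threeCops i) r} _

  twoVerticesDoNotDominate : ∀ c₁ c₂ → ∃ λ r → ¬ ClosedNbhd H̄ c₁ r × ¬ ClosedNbhd H̄ c₂ r
  twoVerticesDoNotDominate =
    toWitness {a? = forall? λ c₁ → forall? λ c₂ → exists? λ r →
                      ¬? (closedNbhd? c₁ r) ×-dec ¬? (closedNbhd? c₂ r)} _

  escapeTwoVertices : ∀ r c₁ c₂ → c₁ ≢ r → c₂ ≢ r →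
                      ∃ λ r′ → ClosedNbhd H̄ r r′ × ¬ ClosedNbhd H̄ c₁ r′ × ¬ ClosedNbhd H̄ c₂ r′
  escapeTwoVertices =
    toWitness {a? = forall? λ r → forall? λ c₁ → forall? λ c₂ →
                      ¬? (c₁ ≟ r) →-dec ¬? (c₂ ≟ r) →-dec exists? λ r′ →
                        closedNbhd? r r′ ×-dec
                        ¬? (closedNbhd? c₁ r′) ×-dec ¬? (closedNbhd? c₂ r′)} _

twoCopsLose : ¬ CopsWin H̄ 2
twoCopsLose = robberEvades H̄ start escape
  where
  outOfReach : ∀ {cs : Fin 2 → Vertex} {r} →
               ¬ ClosedNbhd H̄ (cs zero) r → ¬ ClosedNbhd H̄ (cs (suc zero)) r →
               OutOfReach H̄ cs r
  outOfReach out₀ out₁ zero       = out₀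
  outOfReach out₀ out₁ (suc zero) = out₁

  start : ∀ cs → ∃ (OutOfReach H̄ cs)
  start cs with twoVerticesDoNotDominate (cs zero) (cs (suc zero))
  ... | r , out₀ , out₁ = r , outOfReach out₀ out₁

  escape : ∀ cs r → (∀ i → cs i ≢ r) → ∃ λ r′ → RobberMove H̄ {2} r r′ × OutOfReach H̄ cs r′
  escape cs r free
    with escapeTwoVertices r (cs zero) (cs (suc zero)) (free zero) (free (suc zero))
  ... | r′ , step , out₀ , out₁ = r′ , Sum.map₁ sym step , outOfReach out₀ out₁

fewerThanThreeCopsLose : ∀ k → k < 3 → ¬ CopsWin H̄ k
fewerThanThreeCopsLose k k<3 =
  twoCopsLose ∘ subst (CopsWin H̄) (m+[n∸m]≡n (s≤s⁻¹ k<3)) ∘ copsWin-+ H̄ {k} {2 ∸ k} (zero , zero)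

theorem1p2 : ¬ HasInduced4K1 ShrikhandeComplement
             × (∀ (ℓ : ℕ) → 6 ≤ ℓ → ¬ HasInducedCycle ℓ ShrikhandeComplement)
             × CopNumberIs ShrikhandeComplement 3
theorem1p2 =
  no4K1 ,
  (λ ℓ 6≤ℓ → subst (λ ℓ → ¬ HasInducedCycle ℓ H̄) (m+[n∸m]≡n 6≤ℓ)
                    (noInducedCycleFrom6 (ℓ ∸ 6))) ,
  (dominating⇒copsWin H̄ threeCops threeCopsDominate , fewerThanThreeCopsLose)
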